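{- For all integers $k\ge 2$ and $n\ge k+1$, \[P^{n,k}(r)=r^{N-k}+P^{n-1,k-1}(r),\qquad N=\binom{n}{2}.\]
   Context: For an integer $n\ge 2$ let $N=\binom{n}{2}$. The edges $(i,j)$, $1\le i<j\le n$, of $K_n$ are ordered lexicographically $(1,2),(1,3),\dots,(1,n),(2,3),\dots,(n-1,n)$; $(i,j)$ has index $\mathrm{idx}(i,j)=(i-1)n-\binom{i}{2}+(j-i)$. For a binary string $\mathbf{x}=(x_1,\dots,x_n)$, the cut vector $\delta(\mathbf{x})\in\{0,1\}^N$ has entry $1$ at position $\mathrm{idx}(i,j)$ iff $x_i\ne x_j$. For $\delta\in\{0,1\}^N$ and a variable $r$, $W^n(\delta;r)=\sum_{i=1}^N\delta_i r^{N-i}$. For $1\le k\le n$, $C_k=\delta(1^k0^{n-k})$ in $K_n$ ($k$ ones followed by $n-k$ zeros). For $1\le k\le n-1$, $P^{n,k}(r)=W^n(C_k;r)-W^n(C_{k+1};r)$ (with all objects formed in $K_n$; $P^{n-1,k-1}$ is formed analogously in $K_{n-1}$). -}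

module Defs where

open import Data.Nat using (ℕ; zero; suc; _+_; _*_; _∸_; _≤ᵇ_; _≡ᵇ_)
open import Data.Nat.Combinatorics using (_C_)
open import Data.Integer using (ℤ; +_) renaming (_+_ to _+ℤ_; _-_ to _-ℤ_)
open import Data.Bool using (Bool; true; false; if_then_else_; not)
open import Data.List using (List; []; _∷_; map; concatMap; foldr)
open import Data.Product using (_×_; _,_)

-- Polynomials in one variable r with integer coefficients,
-- represented by their coefficient function: p e = coefficient of r^e.
Poly : Set
Poly = ℕ → ℤ

_≋_ : Poly → Poly → Set
p ≋ q = ∀ e → p e ≡ q e
  where open import Relation.Binary.PropositionalEquality using (_≡_)

0ₚ : Poly
0ₚ _ = + 0

_+ₚ_ : Poly → Poly → Poly
(p +ₚ q) e = p e +ℤ q e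

_-ₚ_ : Poly → Poly → Poly
(p -ₚ q) e = p e -ℤ q e

mono : ℤ → ℕ → Poly
mono c e d = if d ≡ᵇ e then c else + 0

r^ : ℕ → Poly
r^ e = mono (+ 1) e

-- [a , a+1 , ... , b]  (empty if b < a)
range : ℕ → ℕ → List ℕ
range a b = go (suc b ∸ a) a
  where
  go : ℕ → ℕ → List ℕ
  go zero    _ = []
  go (suc m) x = x ∷ go m (suc x)

Nof : ℕ → ℕ
Nof n = n C 2

edges : ℕ → List (ℕ × ℕ)
edges n = concatMap (λ i → map (λ j → (i , j)) (range (suc i) n)) (range 1 n)

xor : Bool → Bool → Bool
xor a b = if a then not b else b

-- cut vector δ(x) ∈ {0,1}^N as a list (entry at position idx(i,j)),
-- where x is the binary string x_1..x_n given as a function on 1..n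
cut : (n : ℕ) → (ℕ → Bool) → List Bool
cut n x = map (λ { (i , j) → xor (x i) (x j) }) (edges n)

-- δ_i for 1 ≤ i (1-based lookup; false outside range)
entry : List Bool → ℕ → Bool
entry []       _             = false
entry (b ∷ _)  1             = b
entry (_ ∷ bs) (suc (suc i)) = entry bs (suc i)
entry (_ ∷ _)  zero          = false

bit : Bool → ℤ
bit true  = + 1
bit false = + 0

W : (n : ℕ) → List Bool → Poly
W n δ = foldr (λ i acc → mono (bit (entry δ i)) (Nof n ∸ i) +ₚ acc) 0ₚ (range 1 (Nof n))

C : (n k : ℕ) → List Bool
C n k = cut n (λ i → i ≤ᵇ k)

P : (n k : ℕ) → Poly
P n k = W n (C n k) -ₚ W n (C n (suc k))

-- In K_{n+1} the edges (1, j) at vertex 1 come first and are followed by a shifted copy of the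
-- edges of K_n. Hence δ(1^{k+1} 0^{n-k}) is the row ([j > k + 1])_{j = 2 … n+1} followed by the cut
-- vector of 1^k 0^{n-k} in K_n, so W^{n+1}(C_{k+1}) is r^{N_n} times that row plus W^n(C_k).
-- The rows of C_{k+1} and C_{k+2} differ only at j = k + 2, whose exponent in K_{n+1} is
-- N_{n+1} - (k + 1); subtracting gives P^{n+1,k+1} = r^{N_{n+1} - (k+1)} + P^{n,k}.
module Submission where

open import Defs
open import Data.Nat using (ℕ; zero; suc; _+_; _∸_; _≤_; _<_; _≤ᵇ_; _≡ᵇ_; s≤s; z<s)
open import Data.Nat.Properties
open import Data.Nat.Combinatorics using (nC1≡n; nCk+nC[k+1]≡[n+1]C[k+1])
open import Data.Integer using () renaming (_+_ to _+ℤ_; _-_ to _-ℤ_)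
import Data.Integer.Properties as ℤ
open import Data.Integer.Tactic.RingSolver using (solve-∀)
open import Data.Bool using (Bool; true; false; not; T)
open import Data.Bool.Properties using (T-≡)
open import Data.List using (List; []; _∷_; _++_; map; length; concatMap; foldr; replicate)
open import Data.List.Properties
  using (map-++; map-∘; map-cong; length-map; length-++; length-replicate; concatMap-cong; concatMap-map; map-concatMap)
open import Data.Product as Product using (_×_; _,_)
open import Function using (_∘_; Equivalence)
open import Relation.Nullary using (yes; no; contradiction)
open import Relation.Binary.PropositionalEquality

countFrom : ℕ → ℕ → List ℕ
countFrom zero    x = []
countFrom (suc m) x = x ∷ countFrom m (suc x)

countFrom-suc : ∀ m x → countFrom m (suc x) ≡ map suc (countFrom m x)
countFrom-suc zero    x = refl
countFrom-suc (suc m) x = cong (suc x ∷_) (countFrom-suc m (suc x))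

countFrom-++ : ∀ p q x → countFrom (p + q) x ≡ countFrom p x ++ countFrom q (x + p)
countFrom-++ zero    q x rewrite +-identityʳ x = refl
countFrom-++ (suc p) q x rewrite +-suc x p = cong (x ∷_) (countFrom-++ p q (suc x))

length-countFrom : ∀ m x → length (countFrom m x) ≡ m
length-countFrom zero    x = refl
length-countFrom (suc m) x = cong suc (length-countFrom m (suc x))

range≡countFrom : ∀ a b → range a b ≡ countFrom (suc b ∸ a) a
range≡countFrom a b = go (suc b ∸ a) a b refl
  where
  go : ∀ m a b → suc b ∸ a ≡ m → range a b ≡ countFrom m a
  go zero    a b eq rewrite eq = refl
  go (suc m) a b eq with a ≤? b
  ... | yes a≤b rewrite +-∸-assoc 1 a≤b = cong (a ∷_) (go m (suc a) b (suc-injective eq))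
  ... | no  a≰b rewrite m≤n⇒m∸n≡0 (≰⇒> a≰b) = contradiction eq 0≢1+n

range-suc : ∀ a b → range (suc a) (suc b) ≡ map suc (range a b)
range-suc a b = begin
  range (suc a) (suc b)           ≡⟨ range≡countFrom (suc a) (suc b) ⟩
  countFrom (suc b ∸ a) (suc a)   ≡⟨ countFrom-suc (suc b ∸ a) a ⟩
  map suc (countFrom (suc b ∸ a) a) ≡⟨ cong (map suc) (range≡countFrom a b) ⟨
  map suc (range a b)             ∎
  where open ≡-Reasoning

edgesFrom : ℕ → ℕ → List (ℕ × ℕ)
edgesFrom n i = map (i ,_) (range (suc i) n)

edges-suc : ∀ n → edges (suc n) ≡ edgesFrom (suc n) 1 ++ map (Product.map suc suc) (edges n)
edges-suc n = cong (edgesFrom (suc n) 1 ++_) (begin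
  concatMap (edgesFrom (suc n)) (range 2 (suc n))        ≡⟨ cong (concatMap (edgesFrom (suc n))) (range-suc 1 n) ⟩
  concatMap (edgesFrom (suc n)) (map suc (range 1 n))    ≡⟨ concatMap-map (edgesFrom (suc n)) suc (range 1 n) ⟩
  concatMap (edgesFrom (suc n) ∘ suc) (range 1 n)        ≡⟨ concatMap-cong edgesFrom-suc (range 1 n) ⟩
  concatMap (map shift ∘ edgesFrom n) (range 1 n)        ≡⟨ map-concatMap shift (edgesFrom n) (range 1 n) ⟨
  map shift (edges n)                                    ∎)
  where
  open ≡-Reasoning
  shift : ℕ × ℕ → ℕ × ℕ
  shift = Product.map suc suc
  edgesFrom-suc : ∀ i → edgesFrom (suc n) (suc i) ≡ map shift (edgesFrom n i)
  edgesFrom-suc i = begin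
    map (suc i ,_) (range (suc (suc i)) (suc n))  ≡⟨ cong (map (suc i ,_)) (range-suc (suc i) n) ⟩
    map (suc i ,_) (map suc (range (suc i) n))    ≡⟨ map-∘ (range (suc i) n) ⟨
    map (shift ∘ (i ,_)) (range (suc i) n)        ≡⟨ map-∘ (range (suc i) n) ⟩
    map shift (edgesFrom n i)                     ∎

cut-suc : ∀ n x → cut (suc n) x ≡ map (λ j → xor (x 1) (x j)) (range 2 (suc n)) ++ cut n (x ∘ suc)
cut-suc n x = begin
  cut (suc n) x
    ≡⟨ cong (map edgeBit) (edges-suc n) ⟩
  map edgeBit (edgesFrom (suc n) 1 ++ map (Product.map suc suc) (edges n))
    ≡⟨ map-++ edgeBit (edgesFrom (suc n) 1) _ ⟩
  map edgeBit (edgesFrom (suc n) 1) ++ map edgeBit (map (Product.map suc suc) (edges n))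
    ≡⟨ cong₂ _++_ (map-∘ (range 2 (suc n))) (map-∘ (edges n)) ⟨
  map (λ j → xor (x 1) (x j)) (range 2 (suc n)) ++ cut n (x ∘ suc)
    ∎
  where
  open ≡-Reasoning
  edgeBit : ℕ × ℕ → Bool
  edgeBit (i , j) = xor (x i) (x j)

cut-cong : ∀ n {x y} → (∀ i → x i ≡ y i) → cut n x ≡ cut n y
cut-cong n x≗y = map-cong (λ (i , j) → cong₂ xor (x≗y i) (x≗y j)) (edges n)

Nof-suc : ∀ n → Nof (suc n) ≡ n + Nof n
Nof-suc n = trans (sym (nCk+nC[k+1]≡[n+1]C[k+1] n 1)) (cong (_+ Nof n) (nC1≡n n))

length-edges : ∀ n → length (edges n) ≡ Nof n
length-edges zero    = refl
length-edges (suc n) = begin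
  length (edges (suc n))
    ≡⟨ cong length (edges-suc n) ⟩
  length (edgesFrom (suc n) 1 ++ map (Product.map suc suc) (edges n))
    ≡⟨ length-++ (edgesFrom (suc n) 1) ⟩
  length (edgesFrom (suc n) 1) + length (map (Product.map suc suc) (edges n))
    ≡⟨ cong₂ _+_ length-edgesFrom (trans (length-map _ (edges n)) (length-edges n)) ⟩
  n + Nof n
    ≡⟨ Nof-suc n ⟨
  Nof (suc n)
    ∎
  where
  open ≡-Reasoning
  length-edgesFrom : length (edgesFrom (suc n) 1) ≡ n
  length-edgesFrom = begin
    length (edgesFrom (suc n) 1)          ≡⟨ length-map _ (range 2 (suc n)) ⟩
    length (range 2 (suc n))              ≡⟨ cong length (range≡countFrom 2 (suc n)) ⟩
    length (countFrom n 2)                ≡⟨ length-countFrom n 2 ⟩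
    n                                     ∎

length-cut : ∀ n x → length (cut n x) ≡ Nof n
length-cut n x = trans (length-map _ (edges n)) (length-edges n)

-- bitsPoly s bs = r^s · Σ bsᵢ r^(|bs| - i): bs read as a coefficient list, leading coefficient first.
bitsPoly : ℕ → List Bool → Poly
bitsPoly s []       = 0ₚ
bitsPoly s (b ∷ bs) = mono (bit b) (s + length bs) +ₚ bitsPoly s bs

bitsPoly-++ : ∀ s xs ys → bitsPoly s (xs ++ ys) ≋ (bitsPoly (s + length ys) xs +ₚ bitsPoly s ys)
bitsPoly-++ s []       ys e = sym (ℤ.+-identityˡ _)
bitsPoly-++ s (x ∷ xs) ys e = begin
  mono (bit x) (s + length (xs ++ ys)) e +ℤ bitsPoly s (xs ++ ys) e
    ≡⟨ cong₂ _+ℤ_ (cong (λ t → mono (bit x) t e) exponent) (bitsPoly-++ s xs ys e) ⟩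
  mono (bit x) (s + length ys + length xs) e +ℤ (bitsPoly (s + length ys) xs e +ℤ bitsPoly s ys e)
    ≡⟨ ℤ.+-assoc (mono (bit x) (s + length ys + length xs) e) _ _ ⟨
  bitsPoly (s + length ys) (x ∷ xs) e +ℤ bitsPoly s ys e
    ∎
  where
  open ≡-Reasoning
  exponent : s + length (xs ++ ys) ≡ s + length ys + length xs
  exponent = begin
    s + length (xs ++ ys)          ≡⟨ cong (s +_) (length-++ xs) ⟩
    s + (length xs + length ys)    ≡⟨ cong (s +_) (+-comm (length xs) (length ys)) ⟩
    s + (length ys + length xs)    ≡⟨ +-assoc s _ _ ⟨
    s + length ys + length xs      ∎

Wsum : ℕ → List Bool → List ℕ → Poly
Wsum N δ = foldr (λ i acc → mono (bit (entry δ i)) (N ∸ i) +ₚ acc) 0ₚ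

Wsum-tail : ∀ N b bs m x → Wsum N (b ∷ bs) (countFrom m (suc (suc x))) ≋ Wsum (N ∸ 1) bs (countFrom m (suc x))
Wsum-tail N b bs zero    x e = refl
Wsum-tail N b bs (suc m) x e =
  cong₂ _+ℤ_ (cong (λ t → mono (bit (entry bs (suc x))) t e) (sym (∸-+-assoc N 1 (suc x))))
             (Wsum-tail N b bs m (suc x) e)

Wsum≋bitsPoly : ∀ N δ → length δ ≡ N → Wsum N δ (countFrom N 1) ≋ bitsPoly 0 δ
Wsum≋bitsPoly _ []       refl e = refl
Wsum≋bitsPoly _ (b ∷ bs) refl e =
  cong (mono (bit b) (length bs) e +ℤ_)
       (trans (Wsum-tail (suc (length bs)) b bs (length bs) 0 e) (Wsum≋bitsPoly (length bs) bs refl e))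

W≋bitsPoly : ∀ n δ → length δ ≡ Nof n → W n δ ≋ bitsPoly 0 δ
W≋bitsPoly n δ |δ|≡N e =
  trans (cong (λ is → Wsum (Nof n) δ is e) (range≡countFrom 1 (Nof n))) (Wsum≋bitsPoly (Nof n) δ |δ|≡N e)

infix 4 _>ᵇ_
_>ᵇ_ : ℕ → ℕ → Bool
j >ᵇ t = not (j ≤ᵇ t)

≤⇒>ᵇ≡false : ∀ {j t} → j ≤ t → (j >ᵇ t) ≡ false
≤⇒>ᵇ≡false j≤t = cong not (Equivalence.to T-≡ (≤⇒≤ᵇ j≤t))

>⇒>ᵇ≡true : ∀ {j t} → t < j → (j >ᵇ t) ≡ true
>⇒>ᵇ≡true {j} {t} t<j with j ≤ᵇ t in eq
... | false = refl
... | true  = contradiction (≤ᵇ⇒≤ j t (subst T (sym eq) _)) (<⇒≱ t<j)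

map-countFrom-const : ∀ (f : ℕ → Bool) b m x → (∀ j → x ≤ j → j < x + m → f j ≡ b) →
                      map f (countFrom m x) ≡ replicate m b
map-countFrom-const f b zero    x f≡b = refl
map-countFrom-const f b (suc m) x f≡b =
  cong₂ _∷_ (f≡b x ≤-refl (m<m+n x z<s))
            (map-countFrom-const f b m (suc x)
              (λ j x<j j<x+1+m → f≡b j (<⇒≤ x<j) (subst (j <_) (sym (+-suc x m)) j<x+1+m)))

-- The bits of C_{k+1} on the edges (1, j), j = 2 … n + 1, of K_{n+1}.
firstRow : ℕ → ℕ → List Bool
firstRow k n = map (_>ᵇ suc k) (range 2 (suc n))

C-suc : ∀ n k → C (suc n) (suc k) ≡ firstRow k n ++ C n k
C-suc n k = trans (cut-suc n (_≤ᵇ suc k)) (cong (firstRow k n ++_) (cut-cong n suc≤ᵇsuc))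
  where
  suc≤ᵇsuc : ∀ i → (suc i ≤ᵇ suc k) ≡ (i ≤ᵇ k)
  suc≤ᵇsuc zero    = refl
  suc≤ᵇsuc (suc i) = refl

W-C-suc : ∀ n k → W (suc n) (C (suc n) (suc k)) ≋ (bitsPoly (Nof n) (firstRow k n) +ₚ W n (C n k))
W-C-suc n k e = begin
  W (suc n) (C (suc n) (suc k)) e
    ≡⟨ W≋bitsPoly (suc n) (C (suc n) (suc k)) (length-cut (suc n) (_≤ᵇ suc k)) e ⟩
  bitsPoly 0 (C (suc n) (suc k)) e
    ≡⟨ cong (λ δ → bitsPoly 0 δ e) (C-suc n k) ⟩
  bitsPoly 0 (firstRow k n ++ C n k) e
    ≡⟨ bitsPoly-++ 0 (firstRow k n) (C n k) e ⟩
  bitsPoly (length (C n k)) (firstRow k n) e +ℤ bitsPoly 0 (C n k) e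
    ≡⟨ cong₂ _+ℤ_ (cong (λ s → bitsPoly s (firstRow k n) e) (length-cut n (_≤ᵇ k)))
                  (sym (W≋bitsPoly n (C n k) (length-cut n (_≤ᵇ k)) e)) ⟩
  bitsPoly (Nof n) (firstRow k n) e +ℤ W n (C n k) e
    ∎
  where open ≡-Reasoning

range-two-split : ∀ k c → range 2 (suc (suc k + c)) ≡ countFrom k 2 ++ countFrom (suc c) (2 + k)
range-two-split k c = begin
  range 2 (suc (suc k + c))  ≡⟨ range≡countFrom 2 (suc (suc k + c)) ⟩
  countFrom (suc k + c) 2    ≡⟨ cong (λ m → countFrom m 2) (+-suc k c) ⟨
  countFrom (k + suc c) 2    ≡⟨ countFrom-++ k (suc c) 2 ⟩
  countFrom k 2 ++ countFrom (suc c) (2 + k) ∎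
  where open ≡-Reasoning

firstRow-at : ∀ k c → firstRow k (suc k + c) ≡ replicate k false ++ true ∷ replicate c true
firstRow-at k c = begin
  map (_>ᵇ suc k) (range 2 (suc (suc k + c)))
    ≡⟨ cong (map _) (range-two-split k c) ⟩
  map (_>ᵇ suc k) (countFrom k 2 ++ countFrom (suc c) (2 + k))
    ≡⟨ map-++ _ (countFrom k 2) _ ⟩
  map (_>ᵇ suc k) (countFrom k 2) ++ map (_>ᵇ suc k) (countFrom (suc c) (2 + k))
    ≡⟨ cong₂ _++_ (map-countFrom-const _ false k 2 (λ j _ j<2+k → ≤⇒>ᵇ≡false (≤-pred j<2+k)))
                  (map-countFrom-const _ true (suc c) (2 + k) (λ j 2+k≤j _ → >⇒>ᵇ≡true 2+k≤j)) ⟩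
  replicate k false ++ replicate (suc c) true
    ∎
  where open ≡-Reasoning

firstRow-suc-at : ∀ k c → firstRow (suc k) (suc k + c) ≡ replicate k false ++ false ∷ replicate c true
firstRow-suc-at k c = begin
  map (_>ᵇ 2 + k) (range 2 (suc (suc k + c)))
    ≡⟨ cong (map _) (range-two-split k c) ⟩
  map (_>ᵇ 2 + k) (countFrom k 2 ++ countFrom (suc c) (2 + k))
    ≡⟨ map-++ _ (countFrom k 2) _ ⟩
  map (_>ᵇ 2 + k) (countFrom k 2) ++ (2 + k >ᵇ 2 + k) ∷ map (_>ᵇ 2 + k) (countFrom c (3 + k))
    ≡⟨ cong₂ _++_ (map-countFrom-const _ false k 2 (λ j _ j<2+k → ≤⇒>ᵇ≡false (<⇒≤ j<2+k)))
                  (cong₂ _∷_ (≤⇒>ᵇ≡false (≤-refl {2 + k}))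
                             (map-countFrom-const _ true c (3 + k) (λ j 3+k≤j _ → >⇒>ᵇ≡true 3+k≤j))) ⟩
  replicate k false ++ false ∷ replicate c true
    ∎
  where open ≡-Reasoning

mono-zero : ∀ t → mono (bit false) t ≋ 0ₚ
mono-zero t e with e ≡ᵇ t
... | true  = refl
... | false = refl

bitsPoly-flip : ∀ s xs ys → (bitsPoly s (xs ++ true ∷ ys) -ₚ bitsPoly s (xs ++ false ∷ ys)) ≋ r^ (s + length ys)
bitsPoly-flip s xs ys e = begin
  bitsPoly s (xs ++ true ∷ ys) e -ℤ bitsPoly s (xs ++ false ∷ ys) e
    ≡⟨ cong₂ _-ℤ_ (bitsPoly-++ s xs (true ∷ ys) e) (bitsPoly-++ s xs (false ∷ ys) e) ⟩
  (X +ℤ (r^ t e +ℤ Y)) -ℤ (X +ℤ (mono (bit false) t e +ℤ Y))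
    ≡⟨ cancel X (r^ t e) (mono (bit false) t e) Y ⟩
  r^ t e -ℤ mono (bit false) t e
    ≡⟨ cong (r^ t e -ℤ_) (mono-zero t e) ⟩
  r^ t e -ℤ 0ₚ e
    ≡⟨ ℤ.+-identityʳ (r^ t e) ⟩
  r^ t e
    ∎
  where
  open ≡-Reasoning
  t = s + length ys
  X = bitsPoly (s + suc (length ys)) xs e
  Y = bitsPoly s ys e
  cancel : ∀ x a b y → (x +ℤ (a +ℤ y)) -ℤ (x +ℤ (b +ℤ y)) ≡ a -ℤ b
  cancel = solve-∀

firstRow-diff : ∀ s k n → k < n → (bitsPoly s (firstRow k n) -ₚ bitsPoly s (firstRow (suc k) n)) ≋ r^ (s + (n ∸ suc k))
firstRow-diff s k n k<n with m≤n⇒∃[o]m+o≡n k<n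
... | c , refl = λ e → begin
  bitsPoly s (firstRow k n) e -ℤ bitsPoly s (firstRow (suc k) n) e
    ≡⟨ cong₂ (λ xs ys → bitsPoly s xs e -ℤ bitsPoly s ys e) (firstRow-at k c) (firstRow-suc-at k c) ⟩
  bitsPoly s (zeros ++ true ∷ ones) e -ℤ bitsPoly s (zeros ++ false ∷ ones) e
    ≡⟨ bitsPoly-flip s zeros ones e ⟩
  r^ (s + length ones) e
    ≡⟨ cong (λ m → r^ (s + m) e) (trans (length-replicate c) (sym (m+n∸m≡n (suc k) c))) ⟩
  r^ (s + (n ∸ suc k)) e
    ∎
  where
  open ≡-Reasoning
  zeros ones : List Bool
  zeros = replicate k false
  ones  = replicate c true

P-suc : ∀ n k → k < n → P (suc n) (suc k) ≋ (r^ (Nof (suc n) ∸ suc k) +ₚ P n k)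
P-suc n k k<n e = begin
  P (suc n) (suc k) e
    ≡⟨ cong₂ _-ℤ_ (W-C-suc n k e) (W-C-suc n (suc k) e) ⟩
  (R₁ +ℤ W₁) -ℤ (R₂ +ℤ W₂)
    ≡⟨ regroup R₁ W₁ R₂ W₂ ⟩
  (R₁ -ℤ R₂) +ℤ (W₁ -ℤ W₂)
    ≡⟨ cong (_+ℤ P n k e) (firstRow-diff (Nof n) k n k<n e) ⟩
  r^ (Nof n + (n ∸ suc k)) e +ℤ P n k e
    ≡⟨ cong (λ t → r^ t e +ℤ P n k e) exponent ⟩
  r^ (Nof (suc n) ∸ suc k) e +ℤ P n k e
    ∎
  where
  open ≡-Reasoning
  R₁ = bitsPoly (Nof n) (firstRow k n) e
  R₂ = bitsPoly (Nof n) (firstRow (suc k) n) e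
  W₁ = W n (C n k) e
  W₂ = W n (C n (suc k)) e
  regroup : ∀ a b c d → (a +ℤ b) -ℤ (c +ℤ d) ≡ (a -ℤ c) +ℤ (b -ℤ d)
  regroup = solve-∀
  exponent : Nof n + (n ∸ suc k) ≡ Nof (suc n) ∸ suc k
  exponent = begin
    Nof n + (n ∸ suc k)   ≡⟨ +-comm (Nof n) (n ∸ suc k) ⟩
    n ∸ suc k + Nof n     ≡⟨ +-∸-comm (Nof n) k<n ⟨
    n + Nof n ∸ suc k     ≡⟨ cong (_∸ suc k) (Nof-suc n) ⟨
    Nof (suc n) ∸ suc k   ∎

mainTheorem6 : (n k : ℕ) → 2 ≤ k → suc k ≤ n →
    P n k ≋ (r^ (Nof n ∸ k) +ₚ P (n ∸ 1) (k ∸ 1))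
mainTheorem6 (suc n) (suc k) _ (s≤s k<n) = P-suc n k k<n
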